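{- Let $n\geq 4$ be an integer, $a=f_n^2$, $b=f_{n+1}^2$, $c=f_{n+2}^2$, let $\ell$ be the least non-negative integer with $\ell b\equiv c\pmod a$, $q=\left\lfloor \frac{a}{a-\ell}\right\rfloor$ and $r=a-q(a-\ell)$. Then: if $n$ is even, $br>cq$; if $n=5$, $br<cq$; if $n\geq 7$ is odd, $br>cq$.
   Context: The Fibonacci numbers are defined by $f_0=0$, $f_1=1$, $f_k=f_{k-1}+f_{k-2}$ for $k\geq 2$. -}

module Defs where

open import Data.Nat using (ℕ; zero; suc; _+_; _*_; _∸_; _^_; _≤_; _<_)
open import Data.Integer using (ℤ; +_; _-_)
open import Data.Integer.Divisibility using (_∣_)
open import Data.Product using (_×_)

fib : ℕ → ℕ
fib zero = 0
fib (suc zero) = 1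
fib (suc (suc k)) = fib (suc k) + fib k

_≡ₘ_[mod_] : ℕ → ℕ → ℕ → Set
infix 4 _≡ₘ_[mod_]
x ≡ₘ y [mod m ] = (+ m) ∣ ((+ x) - (+ y))

IsLeastSol : ℕ → ℕ → ℕ → ℕ → Set
IsLeastSol a b c ℓ = ((ℓ * b) ≡ₘ c [mod a ]) × (∀ m → (m * b) ≡ₘ c [mod a ] → ℓ ≤ m)

IsFloorDiv : ℕ → ℕ → ℕ → Set
IsFloorDiv x d q = (q * d ≤ x) × (x < suc q * d)

{-# OPTIONS --safe #-}

-- Cassini's identity F(n+1) F(n−1) − F(n)² = (−1)ⁿ makes F(n−1)² an inverse of b = F(n+1)² modulo
-- a = F(n)², and gives F(n+2) / F(n+1) ≡ 1 + (−1)ⁿ F(n) F(n−1) (mod a). Squaring, the least solution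
-- is ℓ = 1 + F(n) F(n−3) for even n and ℓ = 1 + 2 F(n) F(n−2) for odd n, so a − ℓ is 2 F(n) F(n−2) − 1,
-- resp. F(n) F(n−3) − 1. Hence (q, r) = (1, ℓ) for even n, (4, F(n) F(n−6) + 4) for odd n ≥ 7 and
-- (6, 1) for n = 5, and the inequalities follow from F(n+2) < 2 F(n+1), i.e. c < 4 b.

module Submission where

open import Defs
open import Data.Nat
  using (ℕ; zero; suc; _+_; _*_; _∸_; _^_; _≤_; _<_; _>_; z≤n; s≤s; NonZero; parity; _≤′_; ≤′-refl; ≤′-step)
open import Data.Nat.Properties
open import Data.Nat.Divisibility using (_∣_; divides; >⇒∤)
open import Data.Nat.Tactic.RingSolver using (solve; solve-∀)
import Data.Integer as ℤ
import Data.Integer.Properties as ℤ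
import Data.Integer.Divisibility.Signed as ℤ
import Data.Integer.Tactic.RingSolver as ℤ-Solver
open import Data.Parity.Base using (Parity; 0ℙ; 1ℙ; _⁻¹)
import Data.Parity.Base as ℙ
open import Data.Parity.Properties using (suc-homo-⁻¹; +-homo-+; *-homo-*)
open import Data.List using (_∷_; [])
open import Data.Product using (_×_; _,_)
open import Relation.Binary.PropositionalEquality
open import Relation.Nullary using (contradiction)

module _ where
  open import Data.Integer using (+_; _-_)

  x+ak≡y+al⇒x≡ₘy : ∀ {a x y} k l → x + a * k ≡ y + a * l → x ≡ₘ y [mod a ]
  x+ak≡y+al⇒x≡ₘy {a} {x} {y} k l eq =
    ℤ.∣⇒∣ᵤ {+ a} {+ x - + y} (ℤ.divides (+ l - + k) (difference (+ x) (+ y) (+ a) (+ k) (+ l) lifted))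
    where
    open ≡-Reasoning
    lift : ∀ z m → + (z + a * m) ≡ + z ℤ.+ + a ℤ.* + m
    lift z m = trans (ℤ.pos-+ z (a * m)) (cong (ℤ._+_ (+ z)) (ℤ.pos-* a m))
    lifted : + x ℤ.+ + a ℤ.* + k ≡ + y ℤ.+ + a ℤ.* + l
    lifted = begin
      + x ℤ.+ + a ℤ.* + k  ≡⟨ lift x k ⟨
      + (x + a * k)        ≡⟨ cong +_ eq ⟩
      + (y + a * l)        ≡⟨ lift y l ⟩
      + y ℤ.+ + a ℤ.* + l  ∎
    shift : ∀ X Y A K L → X - Y ≡ (X ℤ.+ A ℤ.* K) - (Y ℤ.+ A ℤ.* L) ℤ.+ (L - K) ℤ.* A
    shift = ℤ-Solver.solve-∀
    difference : ∀ X Y A K L → X ℤ.+ A ℤ.* K ≡ Y ℤ.+ A ℤ.* L → X - Y ≡ (L - K) ℤ.* A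
    difference X Y A K L e = begin
      X - Y                                                ≡⟨ shift X Y A K L ⟩
      (X ℤ.+ A ℤ.* K) - (Y ℤ.+ A ℤ.* L) ℤ.+ (L - K) ℤ.* A  ≡⟨ cong (ℤ._+ (L - K) ℤ.* A) (ℤ.i≡j⇒i-j≡0 e) ⟩
      ℤ.0ℤ ℤ.+ (L - K) ℤ.* A                               ≡⟨ ℤ.+-identityˡ _ ⟩
      (L - K) ℤ.* A                                        ∎

  ≡ₘ⇒∣∸ : ∀ {a x y z} → x ≡ₘ z [mod a ] → y ≡ₘ z [mod a ] → y ≤ x → a ∣ x ∸ y
  ≡ₘ⇒∣∸ {a} {x} {y} {z} x≡z y≡z y≤x =
    ℤ.∣⇒∣ᵤ (subst (ℤ._∣_ (+ a)) difference (ℤ.∣m∣n⇒∣m-n (ℤ.∣ᵤ⇒∣ {i = + x - + z} x≡z) (ℤ.∣ᵤ⇒∣ {i = + y - + z} y≡z)))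
    where
    open ≡-Reasoning
    cancel : ∀ X Y Z → (X - Z) - (Y - Z) ≡ X - Y
    cancel = ℤ-Solver.solve-∀
    difference : (+ x - + z) - (+ y - + z) ≡ + (x ∸ y)
    difference = begin
      (+ x - + z) - (+ y - + z) ≡⟨ cancel (+ x) (+ y) (+ z) ⟩
      + x - + y                 ≡⟨ ℤ.[+m]-[+n]≡m⊖n x y ⟩
      x ℤ.⊖ y                   ≡⟨ ℤ.⊖-≥ y≤x ⟩
      + (x ∸ y)                 ∎

  ∣-cancelʳ-invertible : ∀ {a b w e} → b * w ≡ₘ 1 [mod a ] → a ∣ e * b → a ∣ e
  ∣-cancelʳ-invertible {a} {b} {w} {e} bw≡1 a∣eb = ℤ.∣⇒∣ᵤ (subst (ℤ._∣_ (+ a)) combination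
    (ℤ.∣m∣n⇒∣m-n (ℤ.∣m⇒∣m*n (+ w) (ℤ.∣ᵤ⇒∣ {i = + (e * b)} a∣eb)) (ℤ.∣n⇒∣m*n (+ e) (ℤ.∣ᵤ⇒∣ {i = + (b * w) - + 1} bw≡1))))
    where
    identity : ∀ E B W → E ℤ.* B ℤ.* W - E ℤ.* (B ℤ.* W - + 1) ≡ E
    identity = ℤ-Solver.solve-∀
    combination : + (e * b) ℤ.* + w - + e ℤ.* (+ (b * w) - + 1) ≡ + e
    combination = trans (cong₂ (λ eb bw → eb ℤ.* + w - + e ℤ.* (bw - + 1)) (ℤ.pos-* e b) (ℤ.pos-* b w))
                        (identity (+ e) (+ b) (+ w))

∣∧<⇒≡0 : ∀ {a e} → a ∣ e → e < a → e ≡ 0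
∣∧<⇒≡0 {e = zero}  _   _   = refl
∣∧<⇒≡0 {e = suc _} a∣e e<a = contradiction a∣e (>⇒∤ e<a)

IsLeastSol⇒≡ : ∀ {a b c w ℓ ℓ₀} → b * w ≡ₘ 1 [mod a ] → ℓ₀ * b ≡ₘ c [mod a ] → ℓ₀ < a →
               IsLeastSol a b c ℓ → ℓ ≡ ℓ₀
IsLeastSol⇒≡ {a} {b} {c} {w} {ℓ} {ℓ₀} invertible ℓ₀-solves ℓ₀<a (ℓ-solves , ℓ-least) =
  ≤-antisym ℓ≤ℓ₀ (m∸n≡0⇒m≤n (∣∧<⇒≡0 a∣ℓ₀∸ℓ (≤-<-trans (m∸n≤m ℓ₀ ℓ) ℓ₀<a)))
  where
  ℓ≤ℓ₀ : ℓ ≤ ℓ₀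
  ℓ≤ℓ₀ = ℓ-least ℓ₀ ℓ₀-solves
  a∣ℓ₀∸ℓ : a ∣ ℓ₀ ∸ ℓ
  a∣ℓ₀∸ℓ = ∣-cancelʳ-invertible {b = b} {w} invertible (subst (a ∣_) (sym (*-distribʳ-∸ b ℓ₀ ℓ))
             (≡ₘ⇒∣∸ {y = ℓ * b} {c} ℓ₀-solves ℓ-solves (*-monoˡ-≤ b ℓ≤ℓ₀)))

IsFloorDiv-unique : ∀ {x d q q′} → IsFloorDiv x d q → IsFloorDiv x d q′ → q ≡ q′
IsFloorDiv-unique {x} {d} (qd≤x , x<[1+q]d) (q′d≤x , x<[1+q′]d) =
  ≤-antisym (below qd≤x x<[1+q′]d) (below q′d≤x x<[1+q]d)
  where
  below : ∀ {m n} → m * d ≤ x → x < suc n * d → m ≤ n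
  below {m} {n} md≤x x<[1+n]d = m<1+n⇒m≤n (*-cancelʳ-< d m (suc n) (≤-<-trans md≤x x<[1+n]d))

r<d⇒IsFloorDiv : ∀ {d q r} → r < d → IsFloorDiv (q * d + r) d q
r<d⇒IsFloorDiv {d} {q} {r} r<d = m≤m+n (q * d) r , subst (q * d + r <_) (+-comm (q * d) d) (+-monoʳ-< (q * d) r<d)

Comparison : (ℕ → ℕ → Set) → ℕ → ℕ → ℕ → Set
Comparison _R_ a b c =
  ∀ ℓ → IsLeastSol a b c ℓ → ∀ q → IsFloorDiv a (a ∸ ℓ) q → (b * (a ∸ q * (a ∸ ℓ))) R (c * q)

-- ℓ₀, d, q₀, r₀ are the values of ℓ, a ∸ ℓ, q, r; an inverse of b modulo a makes ℓ unique
record Certificate (a b c : ℕ) : Set where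
  field
    inverse ℓ₀ d q₀ r₀ : ℕ
    invertible : b * inverse ≡ₘ 1 [mod a ]
    solution   : ℓ₀ * b ≡ₘ c [mod a ]
    split      : a ≡ ℓ₀ + d
    division   : a ≡ q₀ * d + r₀
    r₀<d       : r₀ < d

Certificate⇒Comparison : ∀ {_R_ a b c} (C : Certificate a b c) → let open Certificate C in
            (b * r₀) R (c * q₀) → Comparison _R_ a b c
Certificate⇒Comparison {_R_} {a} {b} {c} C br₀Rcq₀ ℓ ℓ-least q q-floor =
  subst₂ _R_ (cong (b *_) (sym r≡r₀)) (cong (c *_) (sym q≡q₀)) br₀Rcq₀
  where
  open Certificate C
  open ≡-Reasoning
  ℓ₀<a : ℓ₀ < a
  ℓ₀<a = subst (ℓ₀ <_) (sym split) (m<m+n ℓ₀ (≤-<-trans z≤n r₀<d))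
  a∸ℓ≡d : a ∸ ℓ ≡ d
  a∸ℓ≡d = begin
    a ∸ ℓ        ≡⟨ cong₂ _∸_ split (IsLeastSol⇒≡ {a} {b} {c} {inverse} invertible solution ℓ₀<a ℓ-least) ⟩
    ℓ₀ + d ∸ ℓ₀  ≡⟨ m+n∸m≡n ℓ₀ d ⟩
    d            ∎
  q≡q₀ : q ≡ q₀
  q≡q₀ = IsFloorDiv-unique (subst (λ e → IsFloorDiv a e q) a∸ℓ≡d q-floor)
                           (subst (λ x → IsFloorDiv x d q₀) (sym division) (r<d⇒IsFloorDiv {q = q₀} r₀<d))
  r≡r₀ : a ∸ q * (a ∸ ℓ) ≡ r₀
  r≡r₀ = begin
    a ∸ q * (a ∸ ℓ)       ≡⟨ cong₂ (λ q e → a ∸ q * e) q≡q₀ a∸ℓ≡d ⟩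
    a ∸ q₀ * d            ≡⟨ cong (_∸ q₀ * d) division ⟩
    q₀ * d + r₀ ∸ q₀ * d  ≡⟨ m+n∸m≡n (q₀ * d) r₀ ⟩
    r₀                    ∎

square : ∀ m → m ^ 2 ≡ m * m
square m = cong (m *_) (*-identityʳ m)

-- Cassini's identity F(n+1) F(n−1) − F(n)² = (−1)ⁿ for (x, y, p) = (F(n+1), F(n), F(n−1)),
-- the sign given by the parity of n
Cassini : Parity → ℕ → ℕ → ℕ → Set
Cassini 0ℙ x y p = x * p ≡ y * y + 1
Cassini 1ℙ x y p = x * p + 1 ≡ y * y

Cassini-step : ∀ π {y p} → Cassini π (y + p) y p → Cassini (π ⁻¹) (y + p + y) (y + p) y
Cassini-step 0ℙ {y} {p} cassini = +-cancelʳ-≡ (y * y) _ _ (begin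
  (y + p + y) * y + 1 + y * y    ≡⟨ solve (y ∷ p ∷ []) ⟩
  (y + p + y) * y + (y * y + 1)  ≡⟨ cong (_+_ ((y + p + y) * y)) cassini ⟨
  (y + p + y) * y + (y + p) * p  ≡⟨ solve (y ∷ p ∷ []) ⟩
  (y + p) * (y + p) + y * y      ∎)
  where open ≡-Reasoning
Cassini-step 1ℙ {y} {p} cassini = +-cancelʳ-≡ (y * y) _ _ (begin
  (y + p + y) * y + y * y              ≡⟨ cong (_+_ ((y + p + y) * y)) cassini ⟨
  (y + p + y) * y + ((y + p) * p + 1)  ≡⟨ solve (y ∷ p ∷ []) ⟩
  (y + p) * (y + p) + 1 + y * y        ∎)
  where open ≡-Reasoning

fib-cassini : ∀ n → Cassini (parity (suc n)) (fib (2 + n)) (fib (1 + n)) (fib n)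
fib-cassini zero    = refl
fib-cassini (suc n) = subst (λ π → Cassini π (fib (3 + n)) (fib (2 + n)) (fib (1 + n)))
                            (suc-homo-⁻¹ n) (Cassini-step (parity (suc n)) (fib-cassini n))

Cassini⇒invertible : ∀ π {x y p} → Cassini π x y p → x ^ 2 * p ^ 2 ≡ₘ 1 [mod y ^ 2 ]
Cassini⇒invertible 0ℙ {x} {y} {p} cassini rewrite square x | square y | square p =
  x+ak≡y+al⇒x≡ₘy 0 (y * y + 2) (begin
    x * x * (p * p) + y * y * 0    ≡⟨ solve (x ∷ p ∷ y ∷ []) ⟩
    (x * p) * (x * p)              ≡⟨ cong (λ z → z * z) cassini ⟩
    (y * y + 1) * (y * y + 1)      ≡⟨ solve (y ∷ []) ⟩
    1 + y * y * (y * y + 2)        ∎)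
  where open ≡-Reasoning
Cassini⇒invertible 1ℙ {x} {y} {p} cassini rewrite square x | square y | square p =
  x+ak≡y+al⇒x≡ₘy 2 (y * y) (begin
    x * x * (p * p) + y * y * 2      ≡⟨ cong (λ z → x * x * (p * p) + z * 2) cassini ⟨
    x * x * (p * p) + (x * p + 1) * 2  ≡⟨ solve (x ∷ p ∷ []) ⟩
    1 + (x * p + 1) * (x * p + 1)    ≡⟨ cong (λ z → 1 + z * z) cassini ⟩
    1 + y * y * (y * y)              ∎)
  where open ≡-Reasoning

Cassini⁰⇒solution : ∀ {x y p u} → u + y ≡ 2 * p → Cassini 0ℙ x y p →
                    (1 + y * u) * x ^ 2 ≡ₘ (x + y) ^ 2 [mod y ^ 2 ]
Cassini⁰⇒solution {x} {y} {p} {u} u+y≡2p cassini rewrite square (x + y) | square x | square y =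
  x+ak≡y+al⇒x≡ₘy (x * x + 1) (2 * x * y) (begin
    (1 + y * u) * (x * x) + y * y * (x * x + 1)  ≡⟨ solve (x ∷ y ∷ u ∷ []) ⟩
    x * x + y * (u + y) * (x * x) + y * y        ≡⟨ cong (λ z → x * x + y * z * (x * x) + y * y) u+y≡2p ⟩
    x * x + y * (2 * p) * (x * x) + y * y        ≡⟨ solve (x ∷ y ∷ p ∷ []) ⟩
    x * x + 2 * x * y * (x * p) + y * y          ≡⟨ cong (λ z → x * x + 2 * x * y * z + y * y) cassini ⟩
    x * x + 2 * x * y * (y * y + 1) + y * y      ≡⟨ solve (x ∷ y ∷ []) ⟩
    (x + y) * (x + y) + y * y * (2 * x * y)      ∎)
  where open ≡-Reasoning

Cassini¹⇒solution : ∀ {x y p w} → y ≡ p + w → Cassini 1ℙ x y p →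
                    (1 + 2 * y * w) * x ^ 2 ≡ₘ (x + y) ^ 2 [mod y ^ 2 ]
Cassini¹⇒solution {x} {y} {p} {w} y≡p+w cassini rewrite square (x + y) | square x | square y =
  x+ak≡y+al⇒x≡ₘy (2 * x * y + 1) (2 * (x * x)) (begin
    (1 + 2 * y * w) * (x * x) + y * y * (2 * x * y + 1)          ≡⟨ solve (x ∷ y ∷ w ∷ []) ⟩
    (1 + 2 * y * w) * (x * x) + 2 * x * y * (y * y) + y * y
      ≡⟨ cong (λ z → (1 + 2 * y * w) * (x * x) + 2 * x * y * z + y * y) cassini ⟨
    (1 + 2 * y * w) * (x * x) + 2 * x * y * (x * p + 1) + y * y  ≡⟨ solve (x ∷ y ∷ p ∷ w ∷ []) ⟩
    x * x + 2 * y * (p + w) * (x * x) + 2 * x * y + y * y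
      ≡⟨ cong (λ z → x * x + 2 * y * z * (x * x) + 2 * x * y + y * y) y≡p+w ⟨
    x * x + 2 * y * y * (x * x) + 2 * x * y + y * y              ≡⟨ solve (x ∷ y ∷ []) ⟩
    (x + y) * (x + y) + y * y * (2 * (x * x))                    ∎)
  where open ≡-Reasoning

[x+y]^2*q<x^2*r : ∀ {x y q r} .{{_ : NonZero q}} → y < x → 4 * q ≤ r → (x + y) ^ 2 * q < x ^ 2 * r
[x+y]^2*q<x^2*r {x} {y} {q} {r} y<x 4q≤r = begin-strict
  (x + y) ^ 2 * q          <⟨ *-monoˡ-< q (^-monoˡ-< 2 (+-monoʳ-< x y<x)) ⟩
  (x + x) ^ 2 * q          ≡⟨ cong (_* q) (square (x + x)) ⟩
  (x + x) * (x + x) * q    ≡⟨ solve (x ∷ q ∷ []) ⟩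
  x * x * (4 * q)          ≡⟨ cong (_* (4 * q)) (square x) ⟨
  x ^ 2 * (4 * q)          ≤⟨ *-monoʳ-≤ (x ^ 2) 4q≤r ⟩
  x ^ 2 * r                ∎
  where open ≤-Reasoning

fib[n]≤fib[1+n] : ∀ n → fib n ≤ fib (suc n)
fib[n]≤fib[1+n] zero    = z≤n
fib[n]≤fib[1+n] (suc n) = m≤m+n (fib (suc n)) (fib n)

fib-mono-≤ : ∀ {m n} → m ≤ n → fib m ≤ fib n
fib-mono-≤ m≤n = fib-mono-≤′ (≤⇒≤′ m≤n)
  where
  fib-mono-≤′ : ∀ {m n} → m ≤′ n → fib m ≤ fib n
  fib-mono-≤′ ≤′-refl              = ≤-refl
  fib-mono-≤′ (≤′-step {n} m≤′n) = ≤-trans (fib-mono-≤′ m≤′n) (fib[n]≤fib[1+n] n)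

0<fib[1+n] : ∀ n → 0 < fib (suc n)
0<fib[1+n] n = fib-mono-≤ (s≤s (z≤n {n}))

fib[3+n]≡fib[n]+2*fib[1+n] : ∀ n → fib (3 + n) ≡ fib n + 2 * fib (1 + n)
fib[3+n]≡fib[n]+2*fib[1+n] n = shape (fib n) (fib (1 + n))
  where
  shape : ∀ u v → v + u + v ≡ u + 2 * v
  shape = solve-∀

fib[6+n]≡4*fib[3+n]+fib[n] : ∀ n → fib (6 + n) ≡ 4 * fib (3 + n) + fib n
fib[6+n]≡4*fib[3+n]+fib[n] n = shape (fib n) (fib (1 + n))
  where
  shape : ∀ u v → let f₂ = v + u; f₃ = f₂ + v; f₄ = f₃ + f₂; f₅ = f₄ + f₃ in f₅ + f₄ ≡ 4 * f₃ + u
  shape = solve-∀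

fib[n]<fib[3+n] : ∀ n → fib n < fib (3 + n)
fib[n]<fib[3+n] n = subst (fib n <_) (sym (fib[3+n]≡fib[n]+2*fib[1+n] n))
                          (m<m+n (fib n) (m<n⇒m<o*n 2 (0<fib[1+n] n)))

-- (x, y, p, v, u) stand for (F(n+1), F(n), F(n−1), F(n−2), F(n−3)) with n even
even-comparison : ∀ {x y p v u} → x ≡ y + p → p ≡ v + u → y ≡ u + 2 * v → Cassini 0ℙ x y p →
                  1 ≤ u → u ≤ v → Comparison _>_ (y ^ 2) (x ^ 2) ((x + y) ^ 2)
even-comparison {x} {y} {p} {v} {u} x≡y+p p≡v+u y≡u+2v cassini 1≤u u≤v =
  Certificate⇒Comparison {_>_} (certificate (m+[n∸m]≡n 1≤2yv)) ([x+y]^2*q<x^2*r y<x (s≤s (*-mono-≤ 3≤y 1≤u)))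
  where
  1≤v : 1 ≤ v
  1≤v = ≤-trans 1≤u u≤v
  3≤y : 3 ≤ y
  3≤y = subst (3 ≤_) (sym y≡u+2v) (+-mono-≤ 1≤u (*-monoʳ-≤ 2 1≤v))
  1≤2yv : 1 ≤ 2 * y * v
  1≤2yv = *-mono-≤ (*-mono-≤ (m≤m+n 1 1) (≤-trans (m≤m+n 1 2) 3≤y)) 1≤v
  y<x : y < x
  y<x = subst (y <_) (sym x≡y+p) (m<m+n y (subst (0 <_) (sym p≡v+u) (≤-trans 1≤v (m≤m+n v u))))
  u+y≡2p : u + y ≡ 2 * p
  u+y≡2p = begin
    u + y            ≡⟨ cong (u +_) y≡u+2v ⟩
    u + (u + 2 * v)  ≡⟨ solve (u ∷ v ∷ []) ⟩
    2 * (v + u)      ≡⟨ cong (2 *_) p≡v+u ⟨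
    2 * p            ∎
    where open ≡-Reasoning
  certificate : ∀ {d} → 1 + d ≡ 2 * y * v → Certificate (y ^ 2) (x ^ 2) ((x + y) ^ 2)
  certificate {d} 1+d≡2yv = record
    { inverse = p ^ 2 ; ℓ₀ = 1 + y * u ; d = d ; q₀ = 1 ; r₀ = 1 + y * u
    ; invertible = Cassini⇒invertible 0ℙ {x} {y} {p} cassini
    ; solution = Cassini⁰⇒solution {x} {y} {p} {u} u+y≡2p cassini
    ; split = split
    ; division = trans split (solve (y ∷ u ∷ d ∷ []))
    ; r₀<d = +-cancelˡ-< 1 (1 + y * u) d (begin-strict
        2 + y * u      <⟨ +-mono-<-≤ (*-mono-≤ 3≤y 1≤v) (*-monoʳ-≤ y u≤v) ⟩
        y * v + y * v  ≡⟨ solve (y ∷ v ∷ []) ⟩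
        2 * y * v      ≡⟨ 1+d≡2yv ⟨
        1 + d          ∎)
    }
    where
    open ≤-Reasoning
    split : y ^ 2 ≡ 1 + y * u + d
    split = begin-equality
      y ^ 2              ≡⟨ square y ⟩
      y * y              ≡⟨ cong (y *_) y≡u+2v ⟩
      y * (u + 2 * v)    ≡⟨ solve (y ∷ u ∷ v ∷ []) ⟩
      y * u + 2 * y * v  ≡⟨ cong (y * u +_) 1+d≡2yv ⟨
      y * u + (1 + d)    ≡⟨ solve (y ∷ u ∷ d ∷ []) ⟩
      1 + y * u + d      ∎

-- (x, y, p, w, t, s) stand for (F(n+1), F(n), F(n−1), F(n−2), F(n−3), F(n−6)) with n odd
odd-comparison : ∀ {x y p w t s} → x ≡ y + p → y ≡ p + w → p ≡ w + t → y ≡ 4 * t + s →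
                 Cassini 1ℙ x y p → 1 ≤ s → s < t → 13 ≤ y → Comparison _>_ (y ^ 2) (x ^ 2) ((x + y) ^ 2)
odd-comparison {x} {y} {p} {w} {t} {s} x≡y+p y≡p+w p≡w+t y≡4t+s cassini 1≤s s<t 13≤y =
  Certificate⇒Comparison {_>_} (certificate (m+[n∸m]≡n 1≤yt))
            ([x+y]^2*q<x^2*r y<x (+-monoˡ-≤ 4 (≤-trans (n≤1+n 12) (*-mono-≤ 13≤y 1≤s))))
  where
  1≤t : 1 ≤ t
  1≤t = ≤-trans (s≤s z≤n) s<t
  1≤yt : 1 ≤ y * t
  1≤yt = *-mono-≤ (≤-trans (s≤s z≤n) 13≤y) 1≤t
  y<x : y < x
  y<x = subst (y <_) (sym x≡y+p) (m<m+n y (subst (0 <_) (sym p≡w+t) (≤-trans 1≤t (m≤n+m t w))))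
  certificate : ∀ {d} → 1 + d ≡ y * t → Certificate (y ^ 2) (x ^ 2) ((x + y) ^ 2)
  certificate {d} 1+d≡yt = record
    { inverse = p ^ 2 ; ℓ₀ = 1 + 2 * y * w ; d = d ; q₀ = 4 ; r₀ = y * s + 4
    ; invertible = Cassini⇒invertible 1ℙ {x} {y} {p} cassini
    ; solution = Cassini¹⇒solution {x} {y} {p} {w} y≡p+w cassini
    ; split = begin-equality
        y ^ 2                  ≡⟨ square y ⟩
        y * y                  ≡⟨ cong (y *_) y≡p+w ⟩
        y * (p + w)            ≡⟨ cong (λ z → y * (z + w)) p≡w+t ⟩
        y * (w + t + w)        ≡⟨ solve (y ∷ w ∷ t ∷ []) ⟩
        2 * y * w + y * t      ≡⟨ cong (2 * y * w +_) 1+d≡yt ⟨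
        2 * y * w + (1 + d)    ≡⟨ solve (y ∷ w ∷ d ∷ []) ⟩
        1 + 2 * y * w + d      ∎
    ; division = begin-equality
        y ^ 2                  ≡⟨ square y ⟩
        y * y                  ≡⟨ cong (y *_) y≡4t+s ⟩
        y * (4 * t + s)        ≡⟨ solve (y ∷ t ∷ s ∷ []) ⟩
        4 * (y * t) + y * s    ≡⟨ cong (λ z → 4 * z + y * s) 1+d≡yt ⟨
        4 * (1 + d) + y * s    ≡⟨ solve (y ∷ s ∷ d ∷ []) ⟩
        4 * d + (y * s + 4)    ∎
    ; r₀<d = +-cancelˡ-< 1 (y * s + 4) d (begin-strict
        1 + (y * s + 4)        ≡⟨ solve (y ∷ s ∷ []) ⟩
        y * s + 5              <⟨ +-monoʳ-< (y * s) (≤-trans (m≤m+n 6 7) 13≤y) ⟩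
        y * s + y              ≡⟨ solve (y ∷ s ∷ []) ⟩
        y * (1 + s)            ≤⟨ *-monoʳ-≤ y s<t ⟩
        y * t                  ≡⟨ 1+d≡yt ⟨
        1 + d                  ∎)
    }
    where open ≤-Reasoning

five-comparison : Comparison _<_ 25 64 169
five-comparison = Certificate⇒Comparison {_<_} certificate (<ᵇ⇒< 64 1014 _)
  where
  certificate : Certificate 25 64 169
  certificate = record
    { inverse = 9 ; ℓ₀ = 21 ; d = 4 ; q₀ = 6 ; r₀ = 1
    ; invertible = divides 23 refl
    ; solution = divides 47 refl
    ; split = refl
    ; division = refl
    ; r₀<d = s≤s (s≤s z≤n)
    }

fib-even-comparison : ∀ {n} → 4 ≤ n → parity n ≡ 0ℙ →
                      Comparison _>_ (fib n ^ 2) (fib (1 + n) ^ 2) (fib (2 + n) ^ 2)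
fib-even-comparison 4≤n even with m≤n⇒∃[o]m+o≡n 4≤n
... | k , refl = even-comparison refl refl (fib[3+n]≡fib[n]+2*fib[1+n] (1 + k))
                   (subst (λ π → Cassini π (fib (5 + k)) (fib (4 + k)) (fib (3 + k))) even (fib-cassini (3 + k)))
                   (0<fib[1+n] k) (fib[n]≤fib[1+n] (1 + k))

fib-odd-comparison : ∀ {n} → 7 ≤ n → parity n ≡ 1ℙ →
                     Comparison _>_ (fib n ^ 2) (fib (1 + n) ^ 2) (fib (2 + n) ^ 2)
fib-odd-comparison 7≤n odd with m≤n⇒∃[o]m+o≡n 7≤n
... | k , refl = odd-comparison {w = fib (5 + k)} {fib (4 + k)} {fib (1 + k)}
                   refl refl refl (fib[6+n]≡4*fib[3+n]+fib[n] (1 + k))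
                   (subst (λ π → Cassini π (fib (8 + k)) (fib (7 + k)) (fib (6 + k))) odd (fib-cassini (6 + k)))
                   (0<fib[1+n] k) (fib[n]<fib[3+n] (1 + k)) (fib-mono-≤ (m≤m+n 7 k))

parity[2m]≡0 : ∀ {n} m → n ≡ 2 * m → parity n ≡ 0ℙ
parity[2m]≡0 m refl = *-homo-* 2 m

parity[2m+1]≡1 : ∀ {n} m → n ≡ 2 * m + 1 → parity n ≡ 1ℙ
parity[2m+1]≡1 m refl = trans (+-homo-+ (2 * m) 1) (cong (ℙ._+ 1ℙ) (*-homo-* 2 m))

corollary4p14 :
    (n : ℕ) → 4 ≤ n →
    let a = fib n ^ 2
        b = fib (suc n) ^ 2
        c = fib (suc (suc n)) ^ 2
    in (ℓ : ℕ) → IsLeastSol a b c ℓ →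
       (q : ℕ) → IsFloorDiv a (a ∸ ℓ) q →
       let r = a ∸ q * (a ∸ ℓ)
       in ((m : ℕ) → n ≡ 2 * m → b * r > c * q)
        × (n ≡ 5 → b * r < c * q)
        × ((k : ℕ) → n ≡ 2 * k + 1 → 7 ≤ n → b * r > c * q)
corollary4p14 n 4≤n ℓ ℓ-least q q-floor =
    (λ m n≡2m → fib-even-comparison 4≤n (parity[2m]≡0 m n≡2m) ℓ ℓ-least q q-floor)
  , (λ { refl → five-comparison ℓ ℓ-least q q-floor })
  , (λ k n≡2k+1 7≤n → fib-odd-comparison 7≤n (parity[2m+1]≡1 k n≡2k+1) ℓ ℓ-least q q-floor)
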